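{- Consider unit-demand CVRP with capacity $k\ge3$, let $I^*$ be an optimal itinerary in which each tour is a simple cycle through $v_0$ visiting exactly $k$ customers (so $k$ divides $n=|V|$), and let $\chi=w(h(I^*))/w(I^*)$. Then $\min\{2(1-\chi),1\}\,w(I^*)\geq w(\mathcal{C}_k^*)\geq w(\mathcal{C}_{\bmod k}^*)\geq w(\mathcal{C}^*)$.
   Context: Unit-demand CVRP: complete graph $G$ on $V\cup\{v_0\}$ ($V=\{v_1,\dots,v_n\}$ customers each of demand 1, $v_0$ depot), nonnegative symmetric edge weight $w$ satisfying the triangle inequality, capacity $k$; a tour is a cycle through $v_0$ serving at most $k$ customers; an itinerary is a set of tours serving all customers, with weight the total weight of its edges. Standing assumption: there is an optimal itinerary $I^*$ in which every tour is a simple cycle $(v_0,u_1,\dots,u_k,v_0)$ serving exactly $k$ customers. Home-edges are the edges of $I^*$ incident to $v_0$, $h(I^*)$ their set, $w(I^*)>0$. For a set of cycles, its weight is the total weight of its edges. $\mathcal{C}_k^*$: a minimum-weight $k$-cycle packing of $G[V]$, i.e., a set of exactly $n/k$ vertex-disjoint cycles of length $k$ covering $V$. $\mathcal{C}_{\bmod k}^*$: a minimum-weight mod-$k$-cycle packing of $G[V]$, i.e., vertex-disjoint cycles covering each vertex of $V$ exactly once, each of length divisible by $k$. $\mathcal{C}^*$: a minimum-weight cycle packing of $G[V]$, i.e., vertex-disjoint cycles of length at least 3 covering each vertex of $V$ exactly once.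
   Formalization: The edge weights are nonnegative rationals instead of nonnegative reals. -}

module Defs where

open import Data.Nat as ℕ using (ℕ; suc)
open import Data.Nat.Divisibility using (_∣_)
open import Data.Fin using (Fin; zero; suc)
open import Data.List using (List; []; _∷_; _++_; [_]; map; concat; length; allFin)
open import Data.List.Relation.Unary.All using (All)
open import Data.List.Relation.Binary.Permutation.Propositional using (_↭_)
open import Data.Rational using (ℚ; 0ℚ; 1ℚ; _+_; _-_; _*_; _÷_; _⊓_; _≤_; _<_; >-nonZero)
open import Data.Product using (_×_)
open import Relation.Binary.PropositionalEquality using (_≡_; _≢_)

-- Vertices of G: Fin (suc n); 'zero' is the depot v0, 'suc i' is customer v_{i+1}.
-- Customers are indexed by Fin n.

record IsMetric {m : ℕ} (w : Fin m → Fin m → ℚ) : Set where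
  field
    nonneg : ∀ x y → 0ℚ ≤ w x y
    symm   : ∀ x y → w x y ≡ w y x
    tri    : ∀ x y z → w x z ≤ w x y + w y z

pathW : {m : ℕ} → (Fin m → Fin m → ℚ) → List (Fin m) → ℚ
pathW w []           = 0ℚ
pathW w (x ∷ [])     = 0ℚ
pathW w (x ∷ y ∷ xs) = w x y + pathW w (y ∷ xs)

-- a cycle of G[V] given as the cyclic sequence of its customers
cycleW : {n : ℕ} → (Fin (suc n) → Fin (suc n) → ℚ) → List (Fin n) → ℚ
cycleW w []       = 0ℚ
cycleW w (x ∷ xs) = pathW w (map suc (x ∷ xs) ++ [ suc x ])

packW : {n : ℕ} → (Fin (suc n) → Fin (suc n) → ℚ) → List (List (Fin n)) → ℚ
packW w []       = 0ℚ
packW w (c ∷ cs) = cycleW w c + packW w cs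

-- a tour (v0, u1, ..., um, v0) given by its customer sequence u1 ... um
tourW : {n : ℕ} → (Fin (suc n) → Fin (suc n) → ℚ) → List (Fin n) → ℚ
tourW w t = pathW w (zero ∷ map suc t ++ [ zero ])

itW : {n : ℕ} → (Fin (suc n) → Fin (suc n) → ℚ) → List (List (Fin n)) → ℚ
itW w []       = 0ℚ
itW w (t ∷ ts) = tourW w t + itW w ts

lastOf : {A : Set} → A → List A → A
lastOf a []       = a
lastOf a (b ∷ bs) = lastOf b bs

homeTourW : {n : ℕ} → (Fin (suc n) → Fin (suc n) → ℚ) → List (Fin n) → ℚ
homeTourW w []       = 0ℚ
homeTourW w (u ∷ us) = w zero (suc u) + w (suc (lastOf u us)) zero

homeW : {n : ℕ} → (Fin (suc n) → Fin (suc n) → ℚ) → List (List (Fin n)) → ℚ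
homeW w []       = 0ℚ
homeW w (t ∷ ts) = homeTourW w t + homeW w ts

IsItinerary : (n k : ℕ) → List (List (Fin n)) → Set
IsItinerary n k I = All (λ t → 1 ℕ.≤ length t × length t ℕ.≤ k) I × concat I ↭ allFin n

IsPacking : (n : ℕ) → (ℕ → Set) → List (List (Fin n)) → Set
IsPacking n P C = All (λ c → P (length c)) C × concat C ↭ allFin n

IsMinPacking : (n : ℕ) → (ℕ → Set) → (Fin (suc n) → Fin (suc n) → ℚ) → List (List (Fin n)) → Set
IsMinPacking n P w C = IsPacking n P C × (∀ C' → IsPacking n P C' → packW w C ≤ packW w C')

kLen : ℕ → ℕ → Set
kLen k ℓ = ℓ ≡ k

modLen : ℕ → ℕ → Set
modLen k ℓ = 3 ℕ.≤ ℓ × k ∣ ℓ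

anyLen : ℕ → Set
anyLen ℓ = 3 ℕ.≤ ℓ

ratio : (a b : ℚ) → 0ℚ < b → ℚ
ratio a b p = _÷_ a b {{>-nonZero p}}

2ℚ : ℚ
2ℚ = 1ℚ + 1ℚ

-- Shortcutting the depot in a full tour (v0, u1, ..., uk, v0) leaves the k-cycle (u1, ..., uk),
-- whose new chord uk u1 costs, by the triangle inequality, at most the two home-edges and also
-- at most the path u1 ... uk. Hence each such cycle costs at most its tour, and at most twice the
-- tour minus its home-edges. The cycles obtained from I* form a k-cycle packing, which bounds
-- w(C_k*) by w(I*) and by 2 (w(I*) - w(h(I*))) = 2 (1 - χ) w(I*). The remaining inequalities hold
-- because every k-cycle packing is a mod-k packing and every mod-k packing is a cycle packing.
module Submission where

open import Defs
open import Data.Nat as ℕ using (ℕ; suc)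
open import Data.Fin using (Fin)
open import Data.List using (List; length)
open import Data.List.Relation.Unary.All using (All)
open import Data.Rational using (ℚ; 0ℚ; 1ℚ; _-_; _*_; _⊓_; _≤_; _<_)
open import Data.Product using (_×_)
open import Relation.Binary.PropositionalEquality using (_≡_)

open import Data.Fin using (zero; suc)
open import Data.List using ([]; _∷_; _++_; [_]; map)
open import Data.List.Relation.Unary.All as All using ([]; _∷_)
open import Data.Nat.Divisibility using (∣-refl)
import Data.Nat.Properties as ℕₚ
open import Data.Rational using (_+_; -_; 1/_; NonZero; NonNegative; nonNegative; >-nonZero)
open import Data.Rational.Properties
  using (≤-refl; ≤-reflexive; ≤-trans; <⇒≤; +-mono-≤; +-monoˡ-≤; +-monoʳ-≤; +-comm; +-assoc;
         +-identityʳ; *-assoc; *-identityˡ; *-identityʳ; *-inverseˡ; ⊓-glb; *-distribʳ-⊓-nonNeg;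
         module ≤-Reasoning)
open import Data.Rational.Solver using (module +-*-Solver)
open import Data.Product using (_,_; map₁)
open import Relation.Binary.PropositionalEquality using (refl; sym; cong; subst; module ≡-Reasoning)

open +-*-Solver using (solve; _:+_; _:-_; _:*_; _:=_; con)

lastOf-map : {A B : Set} (f : A → B) (a : A) (xs : List A) →
             lastOf (f a) (map f xs) ≡ f (lastOf a xs)
lastOf-map f a []       = refl
lastOf-map f a (b ∷ bs) = lastOf-map f b bs

module _ {m : ℕ} (w : Fin m → Fin m → ℚ) where

  pathW-snoc : ∀ a xs z → pathW w (a ∷ xs ++ [ z ]) ≡ pathW w (a ∷ xs) + w (lastOf a xs) z
  pathW-snoc a []       z = +-comm (w a z) 0ℚ
  pathW-snoc a (b ∷ bs) z = begin
    w a b + pathW w (b ∷ bs ++ [ z ])             ≡⟨ cong (w a b +_) (pathW-snoc b bs z) ⟩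
    w a b + (pathW w (b ∷ bs) + w (lastOf b bs) z) ≡⟨ sym (+-assoc (w a b) _ _) ⟩
    w a b + pathW w (b ∷ bs) + w (lastOf b bs) z   ∎
    where open ≡-Reasoning

  w-lastOf≤pathW : IsMetric w → ∀ a b xs → w a (lastOf b xs) ≤ pathW w (a ∷ b ∷ xs)
  w-lastOf≤pathW M a b []       = ≤-reflexive (sym (+-identityʳ (w a b)))
  w-lastOf≤pathW M a b (c ∷ cs) = begin
    w a (lastOf c cs)                     ≤⟨ w-lastOf≤pathW M a c cs ⟩
    w a c + pathW w (c ∷ cs)              ≤⟨ +-monoˡ-≤ (pathW w (c ∷ cs)) (IsMetric.tri M a b c) ⟩
    w a b + w b c + pathW w (c ∷ cs)      ≡⟨ +-assoc (w a b) (w b c) _ ⟩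
    w a b + (w b c + pathW w (c ∷ cs))    ∎
    where open ≤-Reasoning

module _ {n : ℕ} (w : Fin (suc n) → Fin (suc n) → ℚ) where

  innerW : List (Fin n) → ℚ
  innerW t = pathW w (map suc t)

  cycleW-split : ∀ u us → cycleW w (u ∷ us) ≡ innerW (u ∷ us) + w (suc (lastOf u us)) (suc u)
  cycleW-split u us = begin
    pathW w (suc u ∷ map suc us ++ [ suc u ])                       ≡⟨ pathW-snoc w (suc u) (map suc us) (suc u) ⟩
    innerW (u ∷ us) + w (lastOf (suc u) (map suc us)) (suc u)        ≡⟨ cong (λ x → innerW (u ∷ us) + w x (suc u)) (lastOf-map suc u us) ⟩
    innerW (u ∷ us) + w (suc (lastOf u us)) (suc u)                  ∎
    where open ≡-Reasoning

  tourW-split : ∀ u us → tourW w (u ∷ us) ≡ homeTourW w (u ∷ us) + innerW (u ∷ us)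
  tourW-split u us = begin
    w zero (suc u) + pathW w (suc u ∷ map suc us ++ [ zero ])         ≡⟨ cong (w zero (suc u) +_) (pathW-snoc w (suc u) (map suc us) zero) ⟩
    w zero (suc u) + (P + w (lastOf (suc u) (map suc us)) zero)        ≡⟨ cong (λ x → w zero (suc u) + (P + w x zero)) (lastOf-map suc u us) ⟩
    w zero (suc u) + (P + w (suc (lastOf u us)) zero)                  ≡⟨ solve 3 (λ a p b → a :+ (p :+ b) := (a :+ b) :+ p) refl (w zero (suc u)) P _ ⟩
    homeTourW w (u ∷ us) + P                                           ∎
    where
    P : ℚ
    P = innerW (u ∷ us)
    open ≡-Reasoning

module _ {n : ℕ} {w : Fin (suc n) → Fin (suc n) → ℚ} (M : IsMetric w) where
  open IsMetric M

  cycleW≤tourW : ∀ t → cycleW w t ≤ tourW w t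
  cycleW≤tourW []       = ≤-trans (nonneg zero zero) (≤-reflexive (sym (+-identityʳ (w zero zero))))
  cycleW≤tourW (u ∷ us) = begin
    cycleW w (u ∷ us)                    ≡⟨ cycleW-split w u us ⟩
    P + w L (suc u)                      ≤⟨ +-monoʳ-≤ P (tri L zero (suc u)) ⟩
    P + (w L zero + w zero (suc u))      ≡⟨ solve 3 (λ p b a → p :+ (b :+ a) := (a :+ b) :+ p) refl P (w L zero) (w zero (suc u)) ⟩
    homeTourW w (u ∷ us) + P             ≡⟨ sym (tourW-split w u us) ⟩
    tourW w (u ∷ us)                     ∎
    where
    P : ℚ
    P = innerW w (u ∷ us)
    L : Fin (suc n)
    L = suc (lastOf u us)
    open ≤-Reasoning

  cycleW+2homeTourW≤2tourW : ∀ t → 2 ℕ.≤ length t → cycleW w t + 2ℚ * homeTourW w t ≤ 2ℚ * tourW w t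
  cycleW+2homeTourW≤2tourW (u ∷ []) (ℕ.s≤s ())
  cycleW+2homeTourW≤2tourW (u ∷ v ∷ vs) _ = begin
    cycleW w t + 2ℚ * h                  ≡⟨ cong (_+ 2ℚ * h) (cycleW-split w u (v ∷ vs)) ⟩
    P + w L (suc u) + 2ℚ * h             ≤⟨ +-monoˡ-≤ (2ℚ * h) (+-monoʳ-≤ P chord≤P) ⟩
    P + P + 2ℚ * h                       ≡⟨ solve 2 (λ p h → p :+ p :+ con 2ℚ :* h := con 2ℚ :* (h :+ p)) refl P h ⟩
    2ℚ * (h + P)                         ≡⟨ cong (2ℚ *_) (sym (tourW-split w u (v ∷ vs))) ⟩
    2ℚ * tourW w t                       ∎
    where
    t : List (Fin n)
    t = u ∷ v ∷ vs
    h : ℚ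
    h = homeTourW w t
    P : ℚ
    P = innerW w t
    L : Fin (suc n)
    L = suc (lastOf v vs)
    chord≤P : w L (suc u) ≤ P
    chord≤P = begin
      w L (suc u)                              ≡⟨ symm L (suc u) ⟩
      w (suc u) (suc (lastOf v vs))            ≡⟨ cong (w (suc u)) (sym (lastOf-map suc v vs)) ⟩
      w (suc u) (lastOf (suc v) (map suc vs))  ≤⟨ w-lastOf≤pathW w M (suc u) (suc v) (map suc vs) ⟩
      P                                        ∎
      where open ≤-Reasoning
    open ≤-Reasoning

  packW≤itW : ∀ I → packW w I ≤ itW w I
  packW≤itW []      = ≤-refl
  packW≤itW (t ∷ I) = +-mono-≤ (cycleW≤tourW t) (packW≤itW I)

  packW+2homeW≤2itW : ∀ I → All (λ t → 2 ℕ.≤ length t) I → packW w I + 2ℚ * homeW w I ≤ 2ℚ * itW w I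
  packW+2homeW≤2itW []      []       = ≤-refl
  packW+2homeW≤2itW (t ∷ I) (p ∷ ps) = begin
    cycleW w t + packW w I + 2ℚ * (homeTourW w t + homeW w I)
      ≡⟨ solve 4 (λ c x h H → c :+ x :+ con 2ℚ :* (h :+ H) := (c :+ con 2ℚ :* h) :+ (x :+ con 2ℚ :* H)) refl
           (cycleW w t) (packW w I) (homeTourW w t) (homeW w I) ⟩
    (cycleW w t + 2ℚ * homeTourW w t) + (packW w I + 2ℚ * homeW w I)
      ≤⟨ +-mono-≤ (cycleW+2homeTourW≤2tourW t p) (packW+2homeW≤2itW I ps) ⟩
    2ℚ * tourW w t + 2ℚ * itW w I
      ≡⟨ solve 2 (λ a b → con 2ℚ :* a :+ con 2ℚ :* b := con 2ℚ :* (a :+ b)) refl (tourW w t) (itW w I) ⟩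
    2ℚ * (tourW w t + itW w I)
      ∎
    where open ≤-Reasoning

ratio-*-cancel : ∀ a b (b>0 : 0ℚ < b) → ratio a b b>0 * b ≡ a
ratio-*-cancel a b b>0 = begin
  a * 1/ b * b     ≡⟨ *-assoc a (1/ b) b ⟩
  a * (1/ b * b)   ≡⟨ cong (a *_) (*-inverseˡ b) ⟩
  a * 1ℚ           ≡⟨ *-identityʳ a ⟩
  a                ∎
  where
  instance _ : NonZero b
           _ = >-nonZero b>0
  open ≡-Reasoning

≤-2[1-ratio]* : ∀ {x} a {b} (b>0 : 0ℚ < b) → x + 2ℚ * a ≤ 2ℚ * b → x ≤ 2ℚ * (1ℚ - ratio a b b>0) * b
≤-2[1-ratio]* {x} a {b} b>0 x+2a≤2b = begin
  x                              ≡⟨ solve 2 (λ x y → x := x :+ y :- y) refl x (2ℚ * a) ⟩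
  x + 2ℚ * a - 2ℚ * a            ≤⟨ +-monoˡ-≤ (- (2ℚ * a)) x+2a≤2b ⟩
  2ℚ * b - 2ℚ * a                ≡⟨ cong (λ y → 2ℚ * b - 2ℚ * y) (sym (ratio-*-cancel a b b>0)) ⟩
  2ℚ * b - 2ℚ * (χ * b)          ≡⟨ solve 2 (λ b χ → con 2ℚ :* b :- con 2ℚ :* (χ :* b) := con 2ℚ :* (con 1ℚ :- χ) :* b) refl b χ ⟩
  2ℚ * (1ℚ - χ) * b              ∎
  where
  χ : ℚ
  χ = ratio a b b>0
  open ≤-Reasoning

IsPacking-weaken : ∀ {n} {P Q : ℕ → Set} {C} → (∀ ℓ → P ℓ → Q ℓ) → IsPacking n P C → IsPacking n Q C
IsPacking-weaken P⇒Q = map₁ (All.map (P⇒Q _))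

kLen⇒modLen : ∀ {k} → 3 ℕ.≤ k → ∀ ℓ → kLen k ℓ → modLen k ℓ
kLen⇒modLen k≥3 _ refl = k≥3 , ∣-refl

modLen⇒anyLen : ∀ {k} ℓ → modLen k ℓ → anyLen ℓ
modLen⇒anyLen _ (ℓ≥3 , _) = ℓ≥3

lemma10 : (n k : ℕ) (w : Fin (suc n) → Fin (suc n) → ℚ) → IsMetric w → 3 ℕ.≤ k →
          (I : List (List (Fin n))) → IsItinerary n k I →
          All (λ t → length t ≡ k) I →
          (∀ J → IsItinerary n k J → itW w I ≤ itW w J) →
          (pos : 0ℚ < itW w I) →
          (Ck Cm C : List (List (Fin n))) →
          IsMinPacking n (kLen k) w Ck → IsMinPacking n (modLen k) w Cm → IsMinPacking n anyLen w C →
          (packW w Ck ≤ ((2ℚ * (1ℚ - ratio (homeW w I) (itW w I) pos)) ⊓ 1ℚ) * itW w I)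
          × (packW w Cm ≤ packW w Ck) × (packW w C ≤ packW w Cm)
lemma10 n k w M k≥3 I (_ , I-covers) I-full _ pos Ck Cm C (Ck-packing , Ck-min) (Cm-packing , Cm-min) (_ , C-min) =
    Ck-bound
  , Cm-min Ck (IsPacking-weaken (kLen⇒modLen k≥3) Ck-packing)
  , C-min Cm (IsPacking-weaken (modLen⇒anyLen {k}) Cm-packing)
  where
  W : ℚ
  W = itW w I
  χ : ℚ
  χ = ratio (homeW w I) W pos
  instance _ : NonNegative W
           _ = nonNegative (<⇒≤ pos)
  tours≥2 : All (λ t → 2 ℕ.≤ length t) I
  tours≥2 = All.map (λ |t|≡k → subst (2 ℕ.≤_) (sym |t|≡k) (ℕₚ.≤-trans (ℕₚ.n≤1+n 2) k≥3)) I-full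
  Ck-bound : packW w Ck ≤ ((2ℚ * (1ℚ - χ)) ⊓ 1ℚ) * W
  Ck-bound = begin
    packW w Ck                            ≤⟨ Ck-min I (I-full , I-covers) ⟩
    packW w I                             ≤⟨ ⊓-glb (≤-2[1-ratio]* (homeW w I) pos (packW+2homeW≤2itW M I tours≥2))
                                                   (≤-trans (packW≤itW M I) (≤-reflexive (sym (*-identityˡ W)))) ⟩
    (2ℚ * (1ℚ - χ) * W) ⊓ (1ℚ * W)        ≡⟨ sym (*-distribʳ-⊓-nonNeg W (2ℚ * (1ℚ - χ)) 1ℚ) ⟩
    ((2ℚ * (1ℚ - χ)) ⊓ 1ℚ) * W            ∎
    where open ≤-Reasoning
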